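{- Let $H$ and $K$ be connected graphs, each with $r$ vertices, $V_H=\{x_1,\ldots,x_r\}$ and $V_K=\{y_1,\ldots,y_r\}$, with weight functions $\alpha:V_H\to[0,\infty)$ and $\beta:V_K\to[0,\infty)$ of total weights $A=\sum_{u\in V_H}\alpha(u)$ and $B=\sum_{v\in V_K}\beta(v)$. Let $\sigma$ be a permutation of $\{1,\ldots,r\}$ and let $G_\sigma$ be the graph obtained from the disjoint union of $H$ and $r$ copies $K^{(1)},\ldots,K^{(r)}$ of $K$ by identifying, for each $i=1,\ldots,r$, the vertex $x_i$ of $H$ with the copy of $y_{\sigma(i)}$ in $K^{(i)}$. Give $G_\sigma$ the weight function $\gamma=\alpha+\beta+\cdots+\beta$ ($r$ copies of $\beta$). Then $$ M_{G_{\sigma}}^{\gamma}=rM_H^{\alpha}+r^2M_K^{\beta}+rBM_{H}^{1}+(A+(r-1)B)M_{K}^{1}. $$ In particular, $M_{G_\sigma}^{\gamma}$ does not depend on $\sigma$.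
   Context: For a connected graph $G$ with vertex set $V$, distance function $\operatorname{dist}$, and a function $\rho:V\to\mathbb{R}$, the $\rho$-moment of $G$ at $u$ is $M_G^{\rho}(u)=\sum_{v\in V}\rho(v)\operatorname{dist}(v,u)$ and the $\rho$-moment of $G$ is $M_G^{\rho}=\sum_{u\in V}M_G^{\rho}(u)$; $M_G^1$ denotes the moment for the constant function $1$. The weight function $\gamma$ on $G_\sigma$ is: $\gamma(x_i)=\alpha(x_i)+\beta(y_{\sigma(i)})$ for the identified vertices, and on a non-identified vertex of the copy $K^{(i)}$, $\gamma$ equals $\beta$ of the corresponding vertex of $K$.
   Formalization: The weight functions α and β take values in the nonnegative rationals rather than in $[0,\infty)$. -}

module Defs where

open import Data.Nat using (ℕ; zero; suc) renaming (_≤_ to _≤ℕ_)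
open import Data.Integer using (+_)
open import Data.Rational using (ℚ; 0ℚ; _+_; _*_; _/_)
open import Data.Fin using (Fin)
open import Data.List using (List; []; _∷_; allFin; cartesianProduct)
open import Data.Product using (_×_; _,_; Σ; ∃)
open import Data.Sum using (_⊎_)
open import Data.Fin.Permutation using (Permutation′; _⟨$⟩ʳ_)
open import Relation.Binary.PropositionalEquality using (_≡_)

-- A graph on vertex type V is given by its adjacency relation; it is
-- treated as undirected (an edge joins u and v if Adj u v or Adj v u).
Graph : Set → Set₁
Graph V = V → V → Set

Edge : {V : Set} → Graph V → V → V → Set
Edge Adj u v = Adj u v ⊎ Adj v u

data Walk {V : Set} (Adj : Graph V) : V → V → ℕ → Set where
  nil  : ∀ {u} → Walk Adj u u 0
  cons : ∀ {u w v k} → Edge Adj u w → Walk Adj w v k → Walk Adj u v (suc k)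

Connected : {V : Set} → Graph V → Set
Connected {V} Adj = (u v : V) → ∃ λ k → Walk Adj u v k

IsDist : {V : Set} → Graph V → V → V → ℕ → Set
IsDist Adj u v d = Walk Adj u v d × (∀ k → Walk Adj u v k → d ≤ℕ k)

IsDistFn : {V : Set} → Graph V → (V → V → ℕ) → Set
IsDistFn {V} Adj dist = (u v : V) → IsDist Adj u v (dist u v)

ℕtoℚ : ℕ → ℚ
ℕtoℚ n = (+ n) / 1

sumL : {V : Set} → List V → (V → ℚ) → ℚ
sumL []       f = 0ℚ
sumL (x ∷ xs) f = f x + sumL xs f

-- rho-moment of a graph whose vertex set is enumerated (without repetition) by enum
Moment : {V : Set} → List V → (V → V → ℕ) → (V → ℚ) → ℚ
Moment enum dist ρ = sumL enum (λ u → sumL enum (λ v → ρ v * ℕtoℚ (dist v u)))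

Moment1 : {V : Set} → List V → (V → V → ℕ) → ℚ
Moment1 enum dist = Moment enum dist (λ _ → ℕtoℚ 1)

-- Vertices of G_σ: the pair (i , j) is the copy in K^(i) of the vertex y_j of K.
-- The vertex (i , σ i) is the identified vertex x_i = copy of y_{σ(i)} in K^(i).
-- This lists every vertex of the identified graph exactly once (r + r(r-1) = r^2 vertices).
GVert : ℕ → Set
GVert r = Fin r × Fin r

GEnum : (r : ℕ) → List (GVert r)
GEnum r = cartesianProduct (allFin r) (allFin r)

GAdj : {r : ℕ} → Graph (Fin r) → Graph (Fin r) → Permutation′ r → Graph (GVert r)
GAdj HAdj KAdj σ (i , j) (i' , j') =
  (i ≡ i' × KAdj j j') ⊎ (j ≡ σ ⟨$⟩ʳ i × (j' ≡ σ ⟨$⟩ʳ i' × HAdj i i'))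


open import Data.Fin using (_≟_)
open import Relation.Nullary using (yes; no)

γ : {r : ℕ} → Permutation′ r → (Fin r → ℚ) → (Fin r → ℚ) → GVert r → ℚ
γ σ α β (i , j) with j ≟ σ ⟨$⟩ʳ i
... | yes _ = α i + β j
... | no  _ = β j

sumFin : (r : ℕ) → (Fin r → ℚ) → ℚ
sumFin r f = sumL (allFin r) f

allFinL : (r : ℕ) → List (Fin r)
allFinL r = allFin r

-- In G_σ the distance between vertices of the same copy K^(i) is their distance in K, and
-- between vertices of different copies K^(i), K^(i′) it is the sum of three distances: to the
-- attachment vertex x_i in K, from x_i to x_i′ in H, and on in K. Hence the distance sum from a
-- vertex of K^(i) is an explicit combination of distance sums in H and K; weighting by γ and
-- summing, the permutation σ only reindexes sums over all attachment vertices, so it drops out.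
module Submission where

open import Defs
open import Data.Nat using (ℕ)
open import Data.Fin using (Fin)
open import Data.Rational using (ℚ; 0ℚ; _≤_; _+_; _*_; _-_)
open import Data.Fin.Permutation using (Permutation′)
open import Relation.Binary.PropositionalEquality using (_≡_)

open import Algebra.Bundles using (Ring)
open import Data.Empty using (⊥-elim)
open import Data.Fin using (zero; suc; _≟_; punchIn)
open import Data.Fin.Permutation using (_⟨$⟩ʳ_)
open import Data.Fin.Properties using (punchInᵢ≢i)
open import Data.List using (List; []; _∷_; _++_; map; tabulate; allFin; cartesianProduct)
import Data.Nat as ℕ
import Data.Nat.Coprimality as Coprimality
import Data.Nat.Properties as ℕ
import Data.Integer as ℤ
import Data.Integer.Properties as ℤ
open import Data.Product using (_×_; _,_; proj₁; proj₂)
open import Data.Rational using (mkℚ; 1ℚ; toℚᵘ)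
open import Data.Rational.Properties
  using (normalize-coprime; toℚᵘ-injective; toℚᵘ-homo-+; +-*-ring; +-identityˡ; +-identityʳ; +-assoc; *-assoc; *-identityˡ; *-zeroˡ)
open import Data.Rational.Solver using (module +-*-Solver)
import Data.Rational.Unnormalised as ℚᵘ
import Data.Rational.Unnormalised.Properties as ℚᵘ
open import Data.Sum using (inj₁; inj₂)
open import Function using (_∘_; id)
open import Relation.Binary.PropositionalEquality
  using (refl; sym; trans; cong; cong₂; _≢_; module ≡-Reasoning)
open import Relation.Nullary using (yes; no)

open import Algebra.Properties.Semiring.Sum (Ring.semiring +-*-ring)
  using (sum; sum-syntax; sum-cong-≗; sum-remove; sum-replicate-zero; ∑-distrib-+; ∑-comm; ∑-permute; *-distribˡ-sum)
open +-*-Solver using (solve; _:=_; _:+_; _:*_; _:-_; con)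

ℕtoℚ-+ : ∀ m n → ℕtoℚ (m ℕ.+ n) ≡ ℕtoℚ m + ℕtoℚ n
ℕtoℚ-+ m n = begin
  ℕtoℚ (m ℕ.+ n)        ≡⟨ ℕtoℚ≡mkℚℕ (m ℕ.+ n) ⟩
  mkℚℕ (m ℕ.+ n)        ≡⟨ toℚᵘ-injective (ℚᵘ.≃-trans +ᵘ-homo (ℚᵘ.≃-sym (toℚᵘ-homo-+ (mkℚℕ m) (mkℚℕ n)))) ⟩
  mkℚℕ m + mkℚℕ n       ≡⟨ cong₂ _+_ (ℕtoℚ≡mkℚℕ m) (ℕtoℚ≡mkℚℕ n) ⟨
  ℕtoℚ m + ℕtoℚ n       ∎
  where
  open ≡-Reasoning
  mkℚℕ : ℕ → ℚ
  mkℚℕ k = mkℚ (ℤ.+ k) 0 (Coprimality.sym (Coprimality.1-coprimeTo k))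

  ℕtoℚ≡mkℚℕ : ∀ k → ℕtoℚ k ≡ mkℚℕ k
  ℕtoℚ≡mkℚℕ k = normalize-coprime (Coprimality.sym (Coprimality.1-coprimeTo k))

  +ᵘ-homo : toℚᵘ (mkℚℕ (m ℕ.+ n)) ℚᵘ.≃ (toℚᵘ (mkℚℕ m) ℚᵘ.+ toℚᵘ (mkℚℕ n))
  +ᵘ-homo = ℚᵘ.*≡* (trans (ℤ.*-identityʳ _) (sym (trans (ℤ.*-identityʳ _)
    (cong₂ ℤ._+_ (ℤ.*-identityʳ (ℤ.+ m)) (ℤ.*-identityʳ (ℤ.+ n))))))

ℕtoℚ-+₃ : ∀ a b c → ℕtoℚ (a ℕ.+ b ℕ.+ c) ≡ ℕtoℚ a + ℕtoℚ b + ℕtoℚ c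
ℕtoℚ-+₃ a b c = trans (ℕtoℚ-+ (a ℕ.+ b) c) (cong (_+ ℕtoℚ c) (ℕtoℚ-+ a b))

∑-*ˡ : ∀ {n} c (f : Fin n → ℚ) → ∑[ i < n ] (c * f i) ≡ c * sum f
∑-*ˡ c f = sym (*-distribˡ-sum c f)

∑-const : ∀ n c → ∑[ i < n ] c ≡ ℕtoℚ n * c
∑-const ℕ.zero    c = sym (*-zeroˡ c)
∑-const (ℕ.suc n) c = begin
  c + ∑[ i < n ] c         ≡⟨ cong (c +_) (∑-const n c) ⟩
  c + ℕtoℚ n * c           ≡⟨ solve 2 (λ c m → c :+ m :* c := (con 1ℚ :+ m) :* c) refl c (ℕtoℚ n) ⟩
  (1ℚ + ℕtoℚ n) * c        ≡⟨ cong (_* c) (sym (ℕtoℚ-+ 1 n)) ⟩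
  ℕtoℚ (ℕ.suc n) * c       ∎
  where open ≡-Reasoning

∑-distrib-+₃ : ∀ {n} (f g h : Fin n → ℚ) → ∑[ i < n ] (f i + g i + h i) ≡ sum f + sum g + sum h
∑-distrib-+₃ f g h = trans (∑-distrib-+ (λ i → f i + g i) h) (cong (_+ sum h) (∑-distrib-+ f g))

∑-distrib-− : ∀ {n} (f g : Fin n → ℚ) → ∑[ i < n ] (f i - g i) ≡ sum f - sum g
∑-distrib-− f g = begin
  ∑[ i < _ ] (f i - g i)                        ≡⟨ solve 2 (λ x y → x := x :+ y :- y) refl _ (sum g) ⟩
  ∑[ i < _ ] (f i - g i) + sum g - sum g        ≡⟨ cong (_- sum g) (sym (∑-distrib-+ (λ i → f i - g i) g)) ⟩
  ∑[ i < _ ] (f i - g i + g i) - sum g          ≡⟨ cong (_- sum g) (sum-cong-≗ λ i → solve 2 (λ x y → x :- y :+ y := x) refl (f i) (g i)) ⟩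
  sum f - sum g                                 ∎
  where open ≡-Reasoning

∑-single : ∀ {n} (h : Fin n → ℚ) k → (∀ x → x ≢ k → h x ≡ 0ℚ) → sum h ≡ h k
∑-single {ℕ.suc n} h k vanish = begin
  sum h                                          ≡⟨ sum-remove h ⟩
  h k + ∑[ i < n ] h (punchIn k i)               ≡⟨ cong (h k +_) (sum-cong-≗ λ i → vanish _ (punchInᵢ≢i k i)) ⟩
  h k + ∑[ i < n ] 0ℚ                            ≡⟨ cong (h k +_) (sum-replicate-zero n) ⟩
  h k + 0ℚ                                       ≡⟨ +-identityʳ (h k) ⟩
  h k                                            ∎
  where open ≡-Reasoning

∑-update : ∀ {n} (f g : Fin n → ℚ) k → (∀ x → x ≢ k → f x ≡ g x) → sum f ≡ sum g + (f k - g k)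
∑-update f g k agree = begin
  sum f                              ≡⟨ sum-cong-≗ (λ i → solve 2 (λ x y → x := y :+ (x :- y)) refl (f i) (g i)) ⟩
  ∑[ i < _ ] (g i + (f i - g i))     ≡⟨ ∑-distrib-+ g (λ i → f i - g i) ⟩
  sum g + ∑[ i < _ ] (f i - g i)     ≡⟨ cong (sum g +_) (∑-single (λ i → f i - g i) k difference-vanishes) ⟩
  sum g + (f k - g k)                ∎
  where
  open ≡-Reasoning
  difference-vanishes : ∀ x → x ≢ k → f x - g x ≡ 0ℚ
  difference-vanishes x x≢k rewrite agree x x≢k = solve 1 (λ y → y :- y := con 0ℚ) refl (g x)

∑-linear : ∀ {n} a b (f g : Fin n → ℚ) → ∑[ i < n ] (a * f i + b * g i) ≡ a * sum f + b * sum g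
∑-linear a b f g = trans (∑-distrib-+ (λ i → a * f i) (λ i → b * g i)) (cong₂ _+_ (∑-*ˡ a f) (∑-*ˡ b g))

∑² : ∀ {m n} → (Fin m × Fin n → ℚ) → ℚ
∑² {m} {n} f = ∑[ i < m ] ∑[ j < n ] f (i , j)

∑²-cong : ∀ {m n} {f g : Fin m × Fin n → ℚ} → (∀ p → f p ≡ g p) → ∑² f ≡ ∑² g
∑²-cong f≗g = sum-cong-≗ λ i → sum-cong-≗ λ j → f≗g (i , j)

∑²-*ˡ : ∀ {m n} c (f : Fin m × Fin n → ℚ) → ∑² (λ p → c * f p) ≡ c * ∑² f
∑²-*ˡ c f = trans (sum-cong-≗ λ i → ∑-*ˡ c (λ j → f (i , j))) (∑-*ˡ c (λ i → ∑[ j < _ ] f (i , j)))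

∑²-comm : ∀ {m n} (F : Fin m × Fin n → Fin m × Fin n → ℚ) →
          ∑² (λ p → ∑² (λ q → F p q)) ≡ ∑² (λ q → ∑² (λ p → F p q))
∑²-comm F = begin
  ∑[ a < _ ] ∑[ b < _ ] ∑[ c < _ ] ∑[ d < _ ] F (a , b) (c , d)
    ≡⟨ sum-cong-≗ (λ a → ∑-comm λ b c → ∑[ d < _ ] F (a , b) (c , d)) ⟩
  ∑[ a < _ ] ∑[ c < _ ] ∑[ b < _ ] ∑[ d < _ ] F (a , b) (c , d)
    ≡⟨ sum-cong-≗ (λ a → sum-cong-≗ λ c → ∑-comm λ b d → F (a , b) (c , d)) ⟩
  ∑[ a < _ ] ∑[ c < _ ] ∑[ d < _ ] ∑[ b < _ ] F (a , b) (c , d)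
    ≡⟨ ∑-comm (λ a c → ∑[ d < _ ] ∑[ b < _ ] F (a , b) (c , d)) ⟩
  ∑[ c < _ ] ∑[ a < _ ] ∑[ d < _ ] ∑[ b < _ ] F (a , b) (c , d)
    ≡⟨ sum-cong-≗ (λ c → ∑-comm λ a d → ∑[ b < _ ] F (a , b) (c , d)) ⟩
  ∑[ c < _ ] ∑[ d < _ ] ∑[ a < _ ] ∑[ b < _ ] F (a , b) (c , d)
    ∎
  where open ≡-Reasoning

sumL-cong : ∀ {V : Set} (xs : List V) {f g : V → ℚ} → (∀ x → f x ≡ g x) → sumL xs f ≡ sumL xs g
sumL-cong []       f≗g = refl
sumL-cong (x ∷ xs) f≗g = cong₂ _+_ (f≗g x) (sumL-cong xs f≗g)

sumL-++ : ∀ {V : Set} (xs ys : List V) (f : V → ℚ) → sumL (xs ++ ys) f ≡ sumL xs f + sumL ys f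
sumL-++ []       ys f = sym (+-identityˡ _)
sumL-++ (x ∷ xs) ys f = trans (cong (f x +_) (sumL-++ xs ys f)) (sym (+-assoc (f x) _ _))

sumL-map : ∀ {U V : Set} (g : U → V) (xs : List U) (f : V → ℚ) → sumL (map g xs) f ≡ sumL xs (f ∘ g)
sumL-map g []       f = refl
sumL-map g (x ∷ xs) f = cong (f (g x) +_) (sumL-map g xs f)

sumL-cartesianProduct : ∀ {U V : Set} (xs : List U) (ys : List V) (f : U × V → ℚ) →
  sumL (cartesianProduct xs ys) f ≡ sumL xs (λ x → sumL ys (λ y → f (x , y)))
sumL-cartesianProduct []       ys f = refl
sumL-cartesianProduct (x ∷ xs) ys f =
  trans (sumL-++ (map (x ,_) ys) _ f) (cong₂ _+_ (sumL-map (x ,_) ys f) (sumL-cartesianProduct xs ys f))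

sumL-tabulate : ∀ {V : Set} {n} (g : Fin n → V) (f : V → ℚ) → sumL (tabulate g) f ≡ sum (f ∘ g)
sumL-tabulate {n = ℕ.zero}  g f = refl
sumL-tabulate {n = ℕ.suc n} g f = cong (f (g zero) +_) (sumL-tabulate (g ∘ suc) f)

sumL-allFin : ∀ {n} (f : Fin n → ℚ) → sumL (allFin n) f ≡ sum f
sumL-allFin = sumL-tabulate id

sumL-allFin² : ∀ {m n} (f : Fin m × Fin n → ℚ) → sumL (cartesianProduct (allFin m) (allFin n)) f ≡ ∑² f
sumL-allFin² f = trans (sumL-cartesianProduct (allFin _) (allFin _) f)
  (trans (sumL-allFin (λ i → sumL (allFin _) λ j → f (i , j))) (sum-cong-≗ λ i → sumL-allFin λ j → f (i , j)))

Moment-cong : ∀ {V : Set} (enum : List V) {d d′ : V → V → ℕ} (ρ : V → ℚ) →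
  (∀ u v → d u v ≡ d′ u v) → Moment enum d ρ ≡ Moment enum d′ ρ
Moment-cong enum ρ d≗d′ = sumL-cong enum λ u → sumL-cong enum λ v → cong (λ k → ρ v * ℕtoℚ k) (d≗d′ v u)

transmission : ∀ {n} → (Fin n → Fin n → ℕ) → Fin n → ℚ
transmission {n} d v = ∑[ u < n ] ℕtoℚ (d v u)

Moment-allFin : ∀ {n} (d : Fin n → Fin n → ℕ) (ρ : Fin n → ℚ) →
  Moment (allFin n) d ρ ≡ ∑[ v < n ] (ρ v * transmission d v)
Moment-allFin d ρ = begin
  Moment (allFin _) d ρ
    ≡⟨ sumL-allFin (λ u → sumL (allFin _) (λ v → ρ v * ℕtoℚ (d v u))) ⟩
  ∑[ u < _ ] sumL (allFin _) (λ v → ρ v * ℕtoℚ (d v u))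
    ≡⟨ sum-cong-≗ (λ u → sumL-allFin (λ v → ρ v * ℕtoℚ (d v u))) ⟩
  ∑[ u < _ ] ∑[ v < _ ] (ρ v * ℕtoℚ (d v u))
    ≡⟨ ∑-comm (λ u v → ρ v * ℕtoℚ (d v u)) ⟩
  ∑[ v < _ ] ∑[ u < _ ] (ρ v * ℕtoℚ (d v u))
    ≡⟨ sum-cong-≗ (λ v → ∑-*ˡ (ρ v) (λ u → ℕtoℚ (d v u))) ⟩
  ∑[ v < _ ] (ρ v * transmission d v)
    ∎
  where open ≡-Reasoning

Moment1-allFin : ∀ {n} (d : Fin n → Fin n → ℕ) → Moment1 (allFin n) d ≡ sum (transmission d)
Moment1-allFin d = trans (Moment-allFin d (λ _ → ℕtoℚ 1)) (sum-cong-≗ λ v → *-identityˡ (transmission d v))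

Moment-allFin² : ∀ {m n} (d : Fin m × Fin n → Fin m × Fin n → ℕ) (ρ : Fin m × Fin n → ℚ) →
  Moment (cartesianProduct (allFin m) (allFin n)) d ρ ≡ ∑² (λ v → ρ v * ∑² (λ u → ℕtoℚ (d v u)))
Moment-allFin² {m} {n} d ρ = begin
  Moment vertices d ρ
    ≡⟨ sumL-allFin² (λ u → sumL vertices (λ v → ρ v * ℕtoℚ (d v u))) ⟩
  ∑² (λ u → sumL vertices (λ v → ρ v * ℕtoℚ (d v u)))
    ≡⟨ ∑²-cong (λ u → sumL-allFin² (λ v → ρ v * ℕtoℚ (d v u))) ⟩
  ∑² (λ u → ∑² (λ v → ρ v * ℕtoℚ (d v u)))
    ≡⟨ ∑²-comm (λ u v → ρ v * ℕtoℚ (d v u)) ⟩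
  ∑² (λ v → ∑² (λ u → ρ v * ℕtoℚ (d v u)))
    ≡⟨ ∑²-cong (λ v → ∑²-*ˡ (ρ v) (λ u → ℕtoℚ (d v u))) ⟩
  ∑² (λ v → ρ v * ∑² (λ u → ℕtoℚ (d v u)))
    ∎
  where
  open ≡-Reasoning
  vertices : List (Fin m × Fin n)
  vertices = cartesianProduct (allFin m) (allFin n)

infixl 5 _++ʷ_

_++ʷ_ : ∀ {V : Set} {Adj : Graph V} {a b c m n} → Walk Adj a b m → Walk Adj b c n → Walk Adj a c (m ℕ.+ n)
nil      ++ʷ w′ = w′
cons e w ++ʷ w′ = cons e (w ++ʷ w′)

module _ {V : Set} {Adj : Graph V} {d : V → V → ℕ} (isDist : IsDistFn Adj d) where

  dist-refl : ∀ u → d u u ≡ 0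
  dist-refl u = ℕ.n≤0⇒n≡0 (proj₂ (isDist u u) 0 nil)

  dist-edge : ∀ {u w} → Edge Adj u w → d u w ℕ.≤ 1
  dist-edge {u} {w} e = proj₂ (isDist u w) 1 (cons e nil)

  dist-≤-edge-step : ∀ {u w} v → Edge Adj u w → d u v ℕ.≤ ℕ.suc (d w v)
  dist-≤-edge-step {u} {w} v e = proj₂ (isDist u v) _ (cons e (proj₁ (isDist w v)))

  dist-unique : (D : V → V → ℕ) → (∀ u → D u u ≡ 0) →
                (∀ {u w} v → Edge Adj u w → D u v ℕ.≤ ℕ.suc (D w v)) →
                (∀ u v → Walk Adj u v (D u v)) → ∀ u v → d u v ≡ D u v
  dist-unique D D-refl D-step D-walk u v =
    ℕ.≤-antisym (proj₂ (isDist u v) _ (D-walk u v)) (D≤length (proj₁ (isDist u v)))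
    where
    D≤length : ∀ {u v k} → Walk Adj u v k → D u v ℕ.≤ k
    D≤length {u} nil rewrite D-refl u = ℕ.z≤n
    D≤length {v = v} (cons e w) = ℕ.≤-trans (D-step v e) (ℕ.s≤s (D≤length w))

-- Distances in the glued graph

module Gluing {r : ℕ} (σ : Permutation′ r) (dH dK : Fin r → Fin r → ℕ) where

  s : Fin r → Fin r
  s i = σ ⟨$⟩ʳ i

  -- a shortest route between different copies K^(i), K^(i′) leaves through x_i, crosses H and
  -- enters through x_i′
  routeViaH : Fin r → Fin r → Fin r → Fin r → ℕ
  routeViaH i j i′ j′ = dK j (s i) ℕ.+ dH i i′ ℕ.+ dK (s i′) j′

  gluedDist : GVert r → GVert r → ℕ
  gluedDist (i , j) (i′ , j′) with i ≟ i′
  ... | yes _ = dK j j′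
  ... | no  _ = routeViaH i j i′ j′

  gluedDist-same : ∀ i j j′ → gluedDist (i , j) (i , j′) ≡ dK j j′
  gluedDist-same i j j′ with i ≟ i
  ... | yes _   = refl
  ... | no  i≢i = ⊥-elim (i≢i refl)

  gluedDist-apart : ∀ i j i′ j′ → i′ ≢ i → gluedDist (i , j) (i′ , j′) ≡ routeViaH i j i′ j′
  gluedDist-apart i j i′ j′ i′≢i with i ≟ i′
  ... | yes i≡i′ = ⊥-elim (i′≢i (sym i≡i′))
  ... | no  _    = refl

module GluedGraph {r : ℕ} (H K : Graph (Fin r)) (σ : Permutation′ r)
                  {dH dK : Fin r → Fin r → ℕ} (isDistH : IsDistFn H dH) (isDistK : IsDistFn K dK) where

  open Gluing σ dH dK

  G : Graph (GVert r)
  G = GAdj H K σ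

  walk-inCopy : ∀ i {j j′ k} → Walk K j j′ k → Walk G (i , j) (i , j′) k
  walk-inCopy i nil               = nil
  walk-inCopy i (cons (inj₁ a) w) = cons (inj₁ (inj₁ (refl , a))) (walk-inCopy i w)
  walk-inCopy i (cons (inj₂ a) w) = cons (inj₂ (inj₁ (refl , a))) (walk-inCopy i w)

  walk-throughH : ∀ {i i′ k} → Walk H i i′ k → Walk G (i , s i) (i′ , s i′) k
  walk-throughH nil               = nil
  walk-throughH (cons (inj₁ h) w) = cons (inj₁ (inj₂ (refl , refl , h))) (walk-throughH w)
  walk-throughH (cons (inj₂ h) w) = cons (inj₂ (inj₂ (refl , refl , h))) (walk-throughH w)

  gluedWalk : ∀ p t → Walk G p t (gluedDist p t)
  gluedWalk (i , j) (i′ , j′) with i ≟ i′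
  ... | yes refl = walk-inCopy i (proj₁ (isDistK j j′))
  ... | no  _    = walk-inCopy i (proj₁ (isDistK j (s i)))
                   ++ʷ walk-throughH (proj₁ (isDistH i i′))
                   ++ʷ walk-inCopy i′ (proj₁ (isDistK (s i′) j′))

  step-inCopy : ∀ i {j j₂} t → Edge K j j₂ → gluedDist (i , j) t ℕ.≤ ℕ.suc (gluedDist (i , j₂) t)
  step-inCopy i (i′ , j′) e with i ≟ i′
  ... | yes _ = dist-≤-edge-step isDistK j′ e
  ... | no  _ = ℕ.+-monoˡ-≤ (dK (s i′) j′) (ℕ.+-monoˡ-≤ (dH i i′) (dist-≤-edge-step isDistK (s i) e))

  step-alongH : ∀ {i i₂} t → Edge H i i₂ → gluedDist (i , s i) t ℕ.≤ ℕ.suc (gluedDist (i₂ , s i₂) t)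
  step-alongH {i} {i₂} (i′ , j′) e with i ≟ i′ | i₂ ≟ i′
  ... | yes refl | yes refl = ℕ.n≤1+n _
  ... | yes refl | no  _    = ℕ.≤-trans (ℕ.m≤n+m _ _) (ℕ.n≤1+n _)
  ... | no  _    | yes refl rewrite dist-refl isDistK (s i) =
    ℕ.+-monoˡ-≤ (dK (s i₂) j′) (dist-edge isDistH e)
  ... | no  _    | no  _    rewrite dist-refl isDistK (s i) | dist-refl isDistK (s i₂) =
    ℕ.+-monoˡ-≤ (dK (s i′) j′) (dist-≤-edge-step isDistH i′ e)

  gluedDist-step : ∀ {p q} t → Edge G p q → gluedDist p t ℕ.≤ ℕ.suc (gluedDist q t)
  gluedDist-step {i , _} t (inj₁ (inj₁ (refl , a)))        = step-inCopy i t (inj₁ a)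
  gluedDist-step {i , _} t (inj₂ (inj₁ (refl , a)))        = step-inCopy i t (inj₂ a)
  gluedDist-step         t (inj₁ (inj₂ (refl , refl , h))) = step-alongH t (inj₁ h)
  gluedDist-step         t (inj₂ (inj₂ (refl , refl , h))) = step-alongH t (inj₂ h)

  gluedDist-refl : ∀ p → gluedDist p p ≡ 0
  gluedDist-refl (i , j) = trans (gluedDist-same i j j) (dist-refl isDistK j)

  dist-glued : ∀ {dG} → IsDistFn G dG → ∀ p t → dG p t ≡ gluedDist p t
  dist-glued isDistG = dist-unique isDistG gluedDist gluedDist-refl gluedDist-step gluedWalk

module _ {r : ℕ} (σ : Permutation′ r) (α β : Fin r → ℚ) where

  γ-attachment : ∀ i → γ σ α β (i , σ ⟨$⟩ʳ i) ≡ α i + β (σ ⟨$⟩ʳ i)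
  γ-attachment i with σ ⟨$⟩ʳ i ≟ σ ⟨$⟩ʳ i
  ... | yes _   = refl
  ... | no  j≢j = ⊥-elim (j≢j refl)

  γ-elsewhere : ∀ i j → j ≢ σ ⟨$⟩ʳ i → γ σ α β (i , j) ≡ β j
  γ-elsewhere i j j≢σi with j ≟ σ ⟨$⟩ʳ i
  ... | yes j≡σi = ⊥-elim (j≢σi j≡σi)
  ... | no  _    = refl

  ∑-γ-* : ∀ i (f : Fin r → ℚ) → ∑[ j < r ] (γ σ α β (i , j) * f j) ≡ ∑[ j < r ] (β j * f j) + α i * f (σ ⟨$⟩ʳ i)
  ∑-γ-* i f = begin
    ∑[ j < r ] (γ σ α β (i , j) * f j)
      ≡⟨ ∑-update (λ j → γ σ α β (i , j) * f j) (λ j → β j * f j) k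
                  (λ j j≢k → cong (_* f j) (γ-elsewhere i j j≢k)) ⟩
    ∑[ j < r ] (β j * f j) + (γ σ α β (i , k) * f k - β k * f k)
      ≡⟨ cong (λ x → ∑[ j < r ] (β j * f j) + (x * f k - β k * f k)) (γ-attachment i) ⟩
    ∑[ j < r ] (β j * f j) + ((α i + β k) * f k - β k * f k)
      ≡⟨ solve 4 (λ t a b x → t :+ ((a :+ b) :* x :- b :* x) := t :+ a :* x)
               refl (∑[ j < r ] (β j * f j)) (α i) (β k) (f k) ⟩
    ∑[ j < r ] (β j * f j) + α i * f k
      ∎
    where
    open ≡-Reasoning
    k : Fin r
    k = σ ⟨$⟩ʳ i

-- The moment of the glued distance

module GluedMoment {r : ℕ} (σ : Permutation′ r) {dH dK : Fin r → Fin r → ℕ}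
                   (dH-refl : ∀ i → dH i i ≡ 0) (dK-refl : ∀ j → dK j j ≡ 0) where

  open Gluing σ dH dK

  rq : ℚ
  rq = ℕtoℚ r

  tH tK : Fin r → ℚ
  tH = transmission dH
  tK = transmission dK

  gluedTransmission : GVert r → ℚ
  gluedTransmission v = ∑² (λ u → ℕtoℚ (gluedDist v u))

  ∑-routeViaH : ∀ i j i′ →
    ∑[ j′ < r ] ℕtoℚ (routeViaH i j i′ j′) ≡ rq * ℕtoℚ (dK j (s i)) + rq * ℕtoℚ (dH i i′) + tK (s i′)
  ∑-routeViaH i j i′ = begin
    ∑[ j′ < r ] ℕtoℚ (routeViaH i j i′ j′)
      ≡⟨ sum-cong-≗ (λ j′ → ℕtoℚ-+₃ (dK j (s i)) (dH i i′) (dK (s i′) j′)) ⟩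
    ∑[ j′ < r ] (ℕtoℚ (dK j (s i)) + ℕtoℚ (dH i i′) + ℕtoℚ (dK (s i′) j′))
      ≡⟨ ∑-distrib-+₃ (λ _ → ℕtoℚ (dK j (s i))) (λ _ → ℕtoℚ (dH i i′)) (λ j′ → ℕtoℚ (dK (s i′) j′)) ⟩
    ∑[ j′ < r ] ℕtoℚ (dK j (s i)) + ∑[ j′ < r ] ℕtoℚ (dH i i′) + tK (s i′)
      ≡⟨ cong₂ (λ a b → a + b + tK (s i′)) (∑-const r _) (∑-const r _) ⟩
    rq * ℕtoℚ (dK j (s i)) + rq * ℕtoℚ (dH i i′) + tK (s i′)
      ∎
    where open ≡-Reasoning

  ∑²-routeViaH : ∀ i j →
    ∑² (λ t → ℕtoℚ (routeViaH i j (proj₁ t) (proj₂ t))) ≡ rq * rq * ℕtoℚ (dK j (s i)) + rq * tH i + sum tK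
  ∑²-routeViaH i j = begin
    ∑[ i′ < r ] ∑[ j′ < r ] ℕtoℚ (routeViaH i j i′ j′)
      ≡⟨ sum-cong-≗ (∑-routeViaH i j) ⟩
    ∑[ i′ < r ] (rq * ℕtoℚ (dK j (s i)) + rq * ℕtoℚ (dH i i′) + tK (s i′))
      ≡⟨ ∑-distrib-+₃ (λ _ → rq * ℕtoℚ (dK j (s i))) (λ i′ → rq * ℕtoℚ (dH i i′)) (tK ∘ s) ⟩
    ∑[ i′ < r ] (rq * ℕtoℚ (dK j (s i))) + ∑[ i′ < r ] (rq * ℕtoℚ (dH i i′)) + ∑[ i′ < r ] tK (s i′)
      ≡⟨ cong₂ _+_ (cong₂ _+_ (∑-const r _) (∑-*ˡ rq (λ i′ → ℕtoℚ (dH i i′)))) (sym (∑-permute tK σ)) ⟩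
    rq * (rq * ℕtoℚ (dK j (s i))) + rq * tH i + sum tK
      ≡⟨ cong (λ x → x + rq * tH i + sum tK) (sym (*-assoc rq rq _)) ⟩
    rq * rq * ℕtoℚ (dK j (s i)) + rq * tH i + sum tK
      ∎
    where open ≡-Reasoning

  -- the routes via H are summed over all copies, K^(i) itself included (as a detour through x_i);
  -- the second summand replaces that term by the distances within K
  gluedTransmission-via-routes : ∀ i j → gluedTransmission (i , j) ≡
    (rq * rq * ℕtoℚ (dK j (s i)) + rq * tH i + sum tK) + (tK j - (rq * ℕtoℚ (dK j (s i)) + tK (s i)))
  gluedTransmission-via-routes i j = begin
    ∑[ i′ < r ] ∑[ j′ < r ] ℕtoℚ (gluedDist (i , j) (i′ , j′))
      ≡⟨ ∑-update (λ i′ → ∑[ j′ < r ] ℕtoℚ (gluedDist (i , j) (i′ , j′)))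
                  (λ i′ → ∑[ j′ < r ] ℕtoℚ (routeViaH i j i′ j′)) i
                  (λ i′ i′≢i → sum-cong-≗ λ j′ → cong ℕtoℚ (gluedDist-apart i j i′ j′ i′≢i)) ⟩
    ∑[ i′ < r ] ∑[ j′ < r ] ℕtoℚ (routeViaH i j i′ j′)
      + (∑[ j′ < r ] ℕtoℚ (gluedDist (i , j) (i , j′)) - ∑[ j′ < r ] ℕtoℚ (routeViaH i j i j′))
      ≡⟨ cong₂ (λ a b → a + (b - ∑[ j′ < r ] ℕtoℚ (routeViaH i j i j′)))
               (∑²-routeViaH i j) (sum-cong-≗ λ j′ → cong ℕtoℚ (gluedDist-same i j j′)) ⟩
    allRoutes + (tK j - ∑[ j′ < r ] ℕtoℚ (routeViaH i j i j′))
      ≡⟨ cong (λ x → allRoutes + (tK j - x)) (∑-routeViaH i j i) ⟩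
    allRoutes + (tK j - (rq * δ + rq * ℕtoℚ (dH i i) + tK (s i)))
      ≡⟨ cong (λ k → allRoutes + (tK j - (rq * δ + rq * ℕtoℚ k + tK (s i)))) (dH-refl i) ⟩
    allRoutes + (tK j - (rq * δ + rq * 0ℚ + tK (s i)))
      ≡⟨ solve 5 (λ a t x rq δ → a :+ (t :- (rq :* δ :+ rq :* con 0ℚ :+ x)) := a :+ (t :- (rq :* δ :+ x)))
               refl allRoutes (tK j) (tK (s i)) rq δ ⟩
    allRoutes + (tK j - (rq * δ + tK (s i)))
      ∎
    where
    open ≡-Reasoning
    δ allRoutes : ℚ
    δ = ℕtoℚ (dK j (s i))
    allRoutes = rq * rq * δ + rq * tH i + sum tK

  gluedTransmission-attachment : ∀ i → gluedTransmission (i , s i) ≡ rq * tH i + sum tK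
  gluedTransmission-attachment i = begin
    gluedTransmission (i , s i)
      ≡⟨ gluedTransmission-via-routes i (s i) ⟩
    (rq * rq * ℕtoℚ (dK (s i) (s i)) + rq * tH i + sum tK) + (tK (s i) - (rq * ℕtoℚ (dK (s i) (s i)) + tK (s i)))
      ≡⟨ cong (λ k → (rq * rq * ℕtoℚ k + rq * tH i + sum tK) + (tK (s i) - (rq * ℕtoℚ k + tK (s i)))) (dK-refl (s i)) ⟩
    (rq * rq * 0ℚ + rq * tH i + sum tK) + (tK (s i) - (rq * 0ℚ + tK (s i)))
      ≡⟨ solve 4 (λ rq h m t → (rq :* rq :* con 0ℚ :+ rq :* h :+ m) :+ (t :- (rq :* con 0ℚ :+ t)) := rq :* h :+ m)
               refl rq (tH i) (sum tK) (tK (s i)) ⟩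
    rq * tH i + sum tK
      ∎
    where open ≡-Reasoning

  ∑-gluedTransmission : ∀ j → ∑[ i < r ] gluedTransmission (i , j) ≡ rq * rq * tK j + (rq * sum tH + (rq - 1ℚ) * sum tK)
  ∑-gluedTransmission j = begin
    ∑[ i < r ] gluedTransmission (i , j)
      ≡⟨ sum-cong-≗ (λ i → gluedTransmission-via-routes i j) ⟩
    ∑[ i < r ] ((rq * rq * δ i + rq * tH i + sum tK) + (tK j - (rq * δ i + tK (s i))))
      ≡⟨ ∑-distrib-+ (λ i → rq * rq * δ i + rq * tH i + sum tK) (λ i → tK j - (rq * δ i + tK (s i))) ⟩
    ∑[ i < r ] (rq * rq * δ i + rq * tH i + sum tK) + ∑[ i < r ] (tK j - (rq * δ i + tK (s i)))
      ≡⟨ cong₂ _+_ ∑-allRoutes ∑-correction ⟩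
    (rq * rq * tK j + rq * sum tH + rq * sum tK) + (rq * tK j - (rq * tK j + sum tK))
      ≡⟨ solve 4 (λ rq t h m → (rq :* rq :* t :+ rq :* h :+ rq :* m) :+ (rq :* t :- (rq :* t :+ m))
                               := rq :* rq :* t :+ (rq :* h :+ (rq :- con 1ℚ) :* m))
               refl rq (tK j) (sum tH) (sum tK) ⟩
    rq * rq * tK j + (rq * sum tH + (rq - 1ℚ) * sum tK)
      ∎
    where
    open ≡-Reasoning
    δ : Fin r → ℚ
    δ i = ℕtoℚ (dK j (s i))

    ∑δ : sum δ ≡ tK j
    ∑δ = sym (∑-permute (λ k → ℕtoℚ (dK j k)) σ)

    ∑-allRoutes : ∑[ i < r ] (rq * rq * δ i + rq * tH i + sum tK) ≡ rq * rq * tK j + rq * sum tH + rq * sum tK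
    ∑-allRoutes = trans (∑-distrib-+₃ (λ i → rq * rq * δ i) (λ i → rq * tH i) (λ _ → sum tK))
      (cong₂ _+_ (cong₂ _+_ (trans (∑-*ˡ (rq * rq) δ) (cong (rq * rq *_) ∑δ)) (∑-*ˡ rq tH)) (∑-const r (sum tK)))

    ∑-correction : ∑[ i < r ] (tK j - (rq * δ i + tK (s i))) ≡ rq * tK j - (rq * tK j + sum tK)
    ∑-correction = trans (∑-distrib-− (λ _ → tK j) (λ i → rq * δ i + tK (s i)))
      (cong₂ _-_ (∑-const r (tK j))
        (trans (∑-distrib-+ (λ i → rq * δ i) (tK ∘ s))
          (cong₂ _+_ (trans (∑-*ˡ rq δ) (cong (rq *_) ∑δ)) (sym (∑-permute tK σ)))))

  ∑-attachment-weighted : ∀ (α : Fin r → ℚ) →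
    ∑[ i < r ] (α i * gluedTransmission (i , s i)) ≡ rq * ∑[ i < r ] (α i * tH i) + sum tK * sum α
  ∑-attachment-weighted α = begin
    ∑[ i < r ] (α i * gluedTransmission (i , s i))
      ≡⟨ sum-cong-≗ (λ i → cong (α i *_) (gluedTransmission-attachment i)) ⟩
    ∑[ i < r ] (α i * (rq * tH i + sum tK))
      ≡⟨ sum-cong-≗ (λ i → solve 4 (λ a rq h m → a :* (rq :* h :+ m) := rq :* (a :* h) :+ m :* a)
                                   refl (α i) rq (tH i) (sum tK)) ⟩
    ∑[ i < r ] (rq * (α i * tH i) + sum tK * α i)
      ≡⟨ ∑-linear rq (sum tK) (λ i → α i * tH i) α ⟩
    rq * ∑[ i < r ] (α i * tH i) + sum tK * sum α
      ∎
    where open ≡-Reasoning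

  ∑²-gluedTransmission-weighted : ∀ (β : Fin r → ℚ) →
    ∑[ i < r ] ∑[ j < r ] (β j * gluedTransmission (i , j))
      ≡ rq * rq * ∑[ j < r ] (β j * tK j) + (rq * sum tH + (rq - 1ℚ) * sum tK) * sum β
  ∑²-gluedTransmission-weighted β = begin
    ∑[ i < r ] ∑[ j < r ] (β j * gluedTransmission (i , j))
      ≡⟨ ∑-comm (λ i j → β j * gluedTransmission (i , j)) ⟩
    ∑[ j < r ] ∑[ i < r ] (β j * gluedTransmission (i , j))
      ≡⟨ sum-cong-≗ (λ j → trans (∑-*ˡ (β j) (λ i → gluedTransmission (i , j))) (cong (β j *_) (∑-gluedTransmission j))) ⟩
    ∑[ j < r ] (β j * (rq * rq * tK j + c))
      ≡⟨ sum-cong-≗ (λ j → solve 4 (λ b rq t c → b :* (rq :* rq :* t :+ c) := rq :* rq :* (b :* t) :+ c :* b)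
                                   refl (β j) rq (tK j) c) ⟩
    ∑[ j < r ] (rq * rq * (β j * tK j) + c * β j)
      ≡⟨ ∑-linear (rq * rq) c (λ j → β j * tK j) β ⟩
    rq * rq * ∑[ j < r ] (β j * tK j) + c * sum β
      ∎
    where
    open ≡-Reasoning
    c : ℚ
    c = rq * sum tH + (rq - 1ℚ) * sum tK

  Moment-gluedDist : ∀ α β → Moment (GEnum r) gluedDist (γ σ α β) ≡
    rq * Moment (allFin r) dH α + rq * rq * Moment (allFin r) dK β + rq * sumL (allFin r) β * Moment1 (allFin r) dH
    + (sumL (allFin r) α + (rq - 1ℚ) * sumL (allFin r) β) * Moment1 (allFin r) dK
  Moment-gluedDist α β
    rewrite Moment-allFin dH α | Moment-allFin dK β | Moment1-allFin dH | Moment1-allFin dK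
          | sumL-allFin α | sumL-allFin β = begin
    Moment (GEnum r) gluedDist (γ σ α β)
      ≡⟨ Moment-allFin² gluedDist (γ σ α β) ⟩
    ∑[ i < r ] ∑[ j < r ] (γ σ α β (i , j) * gluedTransmission (i , j))
      ≡⟨ sum-cong-≗ (λ i → ∑-γ-* σ α β i (λ j → gluedTransmission (i , j))) ⟩
    ∑[ i < r ] (∑[ j < r ] (β j * gluedTransmission (i , j)) + α i * gluedTransmission (i , s i))
      ≡⟨ ∑-distrib-+ (λ i → ∑[ j < r ] (β j * gluedTransmission (i , j))) (λ i → α i * gluedTransmission (i , s i)) ⟩
    ∑[ i < r ] ∑[ j < r ] (β j * gluedTransmission (i , j)) + ∑[ i < r ] (α i * gluedTransmission (i , s i))
      ≡⟨ cong₂ _+_ (∑²-gluedTransmission-weighted β) (∑-attachment-weighted α) ⟩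
    (rq * rq * ∑[ j < r ] (β j * tK j) + (rq * sum tH + (rq - 1ℚ) * sum tK) * sum β)
      + (rq * ∑[ i < r ] (α i * tH i) + sum tK * sum α)
      ≡⟨ solve 7 (λ rq a b αh βk mh mk →
                    (rq :* rq :* βk :+ (rq :* mh :+ (rq :- con 1ℚ) :* mk) :* b) :+ (rq :* αh :+ mk :* a)
                    := rq :* αh :+ rq :* rq :* βk :+ rq :* b :* mh :+ (a :+ (rq :- con 1ℚ) :* b) :* mk)
               refl rq (sum α) (sum β) (∑[ i < r ] (α i * tH i)) (∑[ j < r ] (β j * tK j)) (sum tH) (sum tK) ⟩
    rq * ∑[ i < r ] (α i * tH i) + rq * rq * ∑[ j < r ] (β j * tK j) + rq * sum β * sum tH
      + (sum α + (rq - 1ℚ) * sum β) * sum tK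
      ∎
    where open ≡-Reasoning

corollary3p1 :
    (r : ℕ) (H K : Graph (Fin r)) → Connected H → Connected K →
    (α β : Fin r → ℚ) → (∀ i → 0ℚ ≤ α i) → (∀ j → 0ℚ ≤ β j) →
    (σ : Permutation′ r) →
    (dH : Fin r → Fin r → ℕ) → IsDistFn H dH →
    (dK : Fin r → Fin r → ℕ) → IsDistFn K dK →
    (dG : GVert r → GVert r → ℕ) → IsDistFn (GAdj H K σ) dG →
    let A = sumFin r α
        B = sumFin r β
        rq = ℕtoℚ r
    in Moment (GEnum r) dG (γ σ α β)
       ≡ rq * Moment (allFinL r) dH α
         + rq * rq * Moment (allFinL r) dK β
         + rq * B * Moment1 (allFinL r) dH
         + (A + (rq - ℕtoℚ 1) * B) * Moment1 (allFinL r) dK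
corollary3p1 r H K _ _ α β _ _ σ dH isDistH dK isDistK dG isDistG =
  trans (Moment-cong (GEnum r) (γ σ α β) (GluedGraph.dist-glued H K σ isDistH isDistK isDistG))
        (GluedMoment.Moment-gluedDist σ (dist-refl isDistH) (dist-refl isDistK) α β)
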